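{- All closed substitution instances of the following equations (the axioms of standard concurrency) are derivable from the axioms of $\mathrm{ACP}^{\tau}_{\mathrm{drt}}$: $x\parallel y=y\parallel x$; $(x\parallel y)\parallel z=x\parallel(y\parallel z)$; $(x\lfloor\!\lfloor y)\lfloor\!\lfloor z=x\lfloor\!\lfloor(y\parallel z)$; $x\mid y=y\mid x$; $(x\mid y)\mid z=x\mid(y\mid z)$; $x\mid(y\lfloor\!\lfloor z)=(x\mid y)\lfloor\!\lfloor z$.
   Context: Fix a finite set $A$ of basic actions with $\tau,\delta\notin A$, and a commutative and associative function $\gamma:(A\cup\{\tau,\delta\})\times(A\cup\{\tau,\delta\})\to A\cup\{\tau,\delta\}$ with $\gamma(\tau,a)=\gamma(\delta,a)=\delta$ for all $a$. The signature of $\mathrm{ACP}^{\tau}_{\mathrm{drt}}$ consists of the constants $\underline{a}$ ($a\in A$), $\underline{\tau}$, $\underline{\delta}$; the binary operators $+$, $\cdot$, $\parallel$ (parallel composition), $\lfloor\!\lfloor$ (left merge), $\mid$ (communication merge); and the unary operators $\sigma$ (one-time-slice delay), $\partial_H$ for each $H\subseteq A$, $\tau_I$ for each $I\subseteq A$, and $\nu$ (current-time-slice time-out). In terms, $\cdot$ binds strongest and $+$ weakest. A closed substitution instance of an equation is obtained by replacing its variables by closed $\mathrm{ACP}^{\tau}_{\mathrm{drt}}$ terms. The axioms of $\mathrm{ACP}^{\tau}_{\mathrm{drt}}$ are the following equations, where $a,b,c$ range over $A\cup\{\tau,\delta\}$ and $H,I\subseteq A$: $x+y=y+x$; $(x+y)+z=x+(y+z)$;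 $x+x=x$; $(x+y)\cdot z=x\cdot z+y\cdot z$; $(x\cdot y)\cdot z=x\cdot(y\cdot z)$; $x+\underline{\delta}=x$; $\underline{\delta}\cdot x=\underline{\delta}$; $\sigma(x)+\sigma(y)=\sigma(x+y)$; $\sigma(x)\cdot y=\sigma(x\cdot y)$; $\partial_H(\underline a)=\underline a$ if $a\notin H$; $\partial_H(\underline a)=\underline\delta$ if $a\in H$; $\partial_H(x+y)=\partial_H(x)+\partial_H(y)$; $\partial_H(x\cdot y)=\partial_H(x)\cdot\partial_H(y)$; $\partial_H(\sigma(x))=\sigma(\partial_H(x))$; $\tau_I(\underline a)=\underline a$ if $a\notin I$; $\tau_I(\underline a)=\underline\tau$ if $a\in I$; $\tau_I(x+y)=\tau_I(x)+\tau_I(y)$; $\tau_I(x\cdot y)=\tau_I(x)\cdot\tau_I(y)$; $\tau_I(\sigma(x))=\sigma(\tau_I(x))$; $x\parallel y=(x\lfloor\!\lfloor y+y\lfloor\!\lfloor x)+x\mid y$; $\underline a\lfloor\!\lfloor x=\underline a\cdot x$; $\underline a\cdot x\lfloor\!\lfloor y=\underline a\cdot(x\parallel y)$; $\sigma(x)\lfloor\!\lfloor\nu(y)=\underline\delta$; $\sigma(x)\lfloor\!\lfloor(\nu(y)+\sigma(z))=\sigma(x\lfloor\!\lfloor z)$; $(x+y)\lfloor\!\lfloor z=x\lfloor\!\lfloor z+y\lfloor\!\lfloor z$; $\underline a\cdot x\mid\underline b=(\underline a\mid\underline b)\cdot x$; $\underline a\mid\underline b\cdot x=(\underline a\mid\underline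 b)\cdot x$; $\underline a\cdot x\mid\underline b\cdot y=(\underline a\mid\underline b)\cdot(x\parallel y)$; $\nu(x)\mid\sigma(y)=\underline\delta$; $\sigma(x)\mid\nu(y)=\underline\delta$; $\sigma(x)\mid\sigma(y)=\sigma(x\mid y)$; $(x+y)\mid z=x\mid z+y\mid z$; $x\mid(y+z)=x\mid y+x\mid z$; $\underline a\mid\underline b=\underline c$ if $\gamma(a,b)=c$; $\nu(\underline a)=\underline a$; $\nu(x+y)=\nu(x)+\nu(y)$; $\nu(x\cdot y)=\nu(x)\cdot y$; $\nu(\sigma(x))=\underline\delta$; $\underline a\cdot\underline\tau=\underline a$; $\underline a\cdot(\underline\tau\cdot(\nu(x)+y)+\nu(x))=\underline a\cdot(\nu(x)+y)$; $\underline a\cdot(\underline\tau\cdot(\nu(x)+y)+y)=\underline a\cdot(\nu(x)+y)$; $\underline a\cdot(\sigma(\underline\tau\cdot x)+\nu(y))=\underline a\cdot(\sigma(x)+\nu(y))$. -}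

module Defs where

open import Data.Nat using (ℕ)
open import Data.Fin using (Fin)
open import Data.Fin.Subset using (Subset; _∈_)
open import Data.Empty using (⊥)
open import Relation.Nullary using (¬_)
open import Relation.Binary.PropositionalEquality using (_≡_)

data Lab (n : ℕ) : Set where
  act : Fin n → Lab n
  tau : Lab n
  dlt : Lab n

_∈L_ : {n : ℕ} → Lab n → Subset n → Set
act i ∈L H = i ∈ H
tau   ∈L H = ⊥
dlt   ∈L H = ⊥

record IsCommFun {n : ℕ} (γ : Lab n → Lab n → Lab n) : Set where
  field
    comm   : ∀ a b → γ a b ≡ γ b a
    assoc  : ∀ a b c → γ (γ a b) c ≡ γ a (γ b c)
    tau-l  : ∀ a → γ tau a ≡ dlt
    dlt-l  : ∀ a → γ dlt a ≡ dlt

infixr 5 _+ₜ_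
infix  6 _∥_ _⌊⌊_ _∣ₜ_
infixr 7 _·ₜ_

data Term (n : ℕ) : Set where
  con   : Lab n → Term n
  _+ₜ_  : Term n → Term n → Term n
  _·ₜ_  : Term n → Term n → Term n
  _∥_   : Term n → Term n → Term n
  _⌊⌊_  : Term n → Term n → Term n
  _∣ₜ_  : Term n → Term n → Term n
  σ     : Term n → Term n
  ∂     : Subset n → Term n → Term n
  τI    : Subset n → Term n → Term n
  ν     : Term n → Term n

-- Derivability (equational logic) of closed equations from the closed
-- substitution instances of the axioms of ACP^τ_drt.
infix 4 _⊢_≈_
data _⊢_≈_ {n : ℕ} (γ : Lab n → Lab n → Lab n) : Term n → Term n → Set where
  refl  : ∀ {x} → γ ⊢ x ≈ x
  sym   : ∀ {x y} → γ ⊢ x ≈ y → γ ⊢ y ≈ x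
  trans : ∀ {x y z} → γ ⊢ x ≈ y → γ ⊢ y ≈ z → γ ⊢ x ≈ z
  +-cong  : ∀ {x x' y y'} → γ ⊢ x ≈ x' → γ ⊢ y ≈ y' → γ ⊢ x +ₜ y ≈ x' +ₜ y'
  ·-cong  : ∀ {x x' y y'} → γ ⊢ x ≈ x' → γ ⊢ y ≈ y' → γ ⊢ x ·ₜ y ≈ x' ·ₜ y'
  ∥-cong  : ∀ {x x' y y'} → γ ⊢ x ≈ x' → γ ⊢ y ≈ y' → γ ⊢ x ∥ y ≈ x' ∥ y'
  ⌊⌊-cong : ∀ {x x' y y'} → γ ⊢ x ≈ x' → γ ⊢ y ≈ y' → γ ⊢ x ⌊⌊ y ≈ x' ⌊⌊ y'
  ∣-cong  : ∀ {x x' y y'} → γ ⊢ x ≈ x' → γ ⊢ y ≈ y' → γ ⊢ x ∣ₜ y ≈ x' ∣ₜ y'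
  σ-cong  : ∀ {x x'} → γ ⊢ x ≈ x' → γ ⊢ σ x ≈ σ x'
  ∂-cong  : ∀ {H x x'} → γ ⊢ x ≈ x' → γ ⊢ ∂ H x ≈ ∂ H x'
  τI-cong : ∀ {I x x'} → γ ⊢ x ≈ x' → γ ⊢ τI I x ≈ τI I x'
  ν-cong  : ∀ {x x'} → γ ⊢ x ≈ x' → γ ⊢ ν x ≈ ν x'
  A1 : ∀ x y → γ ⊢ x +ₜ y ≈ y +ₜ x
  A2 : ∀ x y z → γ ⊢ (x +ₜ y) +ₜ z ≈ x +ₜ (y +ₜ z)
  A3 : ∀ x → γ ⊢ x +ₜ x ≈ x
  A4 : ∀ x y z → γ ⊢ (x +ₜ y) ·ₜ z ≈ x ·ₜ z +ₜ y ·ₜ z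
  A5 : ∀ x y z → γ ⊢ (x ·ₜ y) ·ₜ z ≈ x ·ₜ (y ·ₜ z)
  A6 : ∀ x → γ ⊢ x +ₜ con dlt ≈ x
  A7 : ∀ x → γ ⊢ con dlt ·ₜ x ≈ con dlt
  DRT1 : ∀ x y → γ ⊢ σ x +ₜ σ y ≈ σ (x +ₜ y)
  DRT2 : ∀ x y → γ ⊢ σ x ·ₜ y ≈ σ (x ·ₜ y)
  D1 : ∀ H a → ¬ (a ∈L H) → γ ⊢ ∂ H (con a) ≈ con a
  D2 : ∀ H a → a ∈L H → γ ⊢ ∂ H (con a) ≈ con dlt
  D3 : ∀ H x y → γ ⊢ ∂ H (x +ₜ y) ≈ ∂ H x +ₜ ∂ H y
  D4 : ∀ H x y → γ ⊢ ∂ H (x ·ₜ y) ≈ ∂ H x ·ₜ ∂ H y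
  D5 : ∀ H x → γ ⊢ ∂ H (σ x) ≈ σ (∂ H x)
  T1 : ∀ I a → ¬ (a ∈L I) → γ ⊢ τI I (con a) ≈ con a
  T2 : ∀ I a → a ∈L I → γ ⊢ τI I (con a) ≈ con tau
  T3 : ∀ I x y → γ ⊢ τI I (x +ₜ y) ≈ τI I x +ₜ τI I y
  T4 : ∀ I x y → γ ⊢ τI I (x ·ₜ y) ≈ τI I x ·ₜ τI I y
  T5 : ∀ I x → γ ⊢ τI I (σ x) ≈ σ (τI I x)
  CM1  : ∀ x y → γ ⊢ x ∥ y ≈ (x ⌊⌊ y +ₜ y ⌊⌊ x) +ₜ x ∣ₜ y
  CM2  : ∀ a x → γ ⊢ con a ⌊⌊ x ≈ con a ·ₜ x
  CM3  : ∀ a x y → γ ⊢ (con a ·ₜ x) ⌊⌊ y ≈ con a ·ₜ (x ∥ y)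
  CM4a : ∀ x y → γ ⊢ σ x ⌊⌊ ν y ≈ con dlt
  CM4b : ∀ x y z → γ ⊢ σ x ⌊⌊ (ν y +ₜ σ z) ≈ σ (x ⌊⌊ z)
  CM5  : ∀ x y z → γ ⊢ (x +ₜ y) ⌊⌊ z ≈ x ⌊⌊ z +ₜ y ⌊⌊ z
  CM6  : ∀ a b x → γ ⊢ (con a ·ₜ x) ∣ₜ con b ≈ (con a ∣ₜ con b) ·ₜ x
  CM7  : ∀ a b x → γ ⊢ con a ∣ₜ (con b ·ₜ x) ≈ (con a ∣ₜ con b) ·ₜ x
  CM8  : ∀ a b x y → γ ⊢ (con a ·ₜ x) ∣ₜ (con b ·ₜ y) ≈ (con a ∣ₜ con b) ·ₜ (x ∥ y)
  CM9a : ∀ x y → γ ⊢ ν x ∣ₜ σ y ≈ con dlt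
  CM9b : ∀ x y → γ ⊢ σ x ∣ₜ ν y ≈ con dlt
  CM9c : ∀ x y → γ ⊢ σ x ∣ₜ σ y ≈ σ (x ∣ₜ y)
  CM10 : ∀ x y z → γ ⊢ (x +ₜ y) ∣ₜ z ≈ x ∣ₜ z +ₜ y ∣ₜ z
  CM11 : ∀ x y z → γ ⊢ x ∣ₜ (y +ₜ z) ≈ x ∣ₜ y +ₜ x ∣ₜ z
  CF   : ∀ a b c → γ a b ≡ c → γ ⊢ con a ∣ₜ con b ≈ con c
  NU1 : ∀ a → γ ⊢ ν (con a) ≈ con a
  NU2 : ∀ x y → γ ⊢ ν (x +ₜ y) ≈ ν x +ₜ ν y
  NU3 : ∀ x y → γ ⊢ ν (x ·ₜ y) ≈ ν x ·ₜ y
  NU4 : ∀ x → γ ⊢ ν (σ x) ≈ con dlt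
  B1 : ∀ a → γ ⊢ con a ·ₜ con tau ≈ con a
  B2 : ∀ a x y → γ ⊢ con a ·ₜ (con tau ·ₜ (ν x +ₜ y) +ₜ ν x) ≈ con a ·ₜ (ν x +ₜ y)
  B3 : ∀ a x y → γ ⊢ con a ·ₜ (con tau ·ₜ (ν x +ₜ y) +ₜ y) ≈ con a ·ₜ (ν x +ₜ y)
  B4 : ∀ a x y → γ ⊢ con a ·ₜ (σ (con tau ·ₜ x) +ₜ ν y) ≈ con a ·ₜ (σ x +ₜ ν y)

-- Every closed term is derivably equal to a basic term u + σ(p), or to u, where u is a
-- sum of actions a and prefixed terms a · q whose continuations p, q are basic again
-- (elimination).  On basic terms the six laws hold by simultaneous induction: both merges
-- distribute over summands, act on prefixes through CM2, CM3 and CM6-CM8 (so that γ's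
-- commutativity and associativity give those of ∣), and act on the delayed summands
-- through CM4 and CM9, which apply because the undelayed part u is fixed by ν.
module Submission where

open import Defs
open import Algebra.Bundles using (IdempotentCommutativeMonoid)
import Algebra.Solver.IdempotentCommutativeMonoid as IdempotentCommutativeMonoidSolver
open import Data.Fin.Subset using (Subset)
open import Data.Fin.Subset.Properties using (_∈?_)
open import Data.Maybe using (Maybe; just; nothing; zipWith)
open import Data.Maybe.Relation.Unary.All using (All; just; nothing)
open import Data.Maybe.Relation.Binary.Pointwise using (Pointwise; just; nothing)
import Data.Maybe.Relation.Binary.Pointwise as Pointwise
open import Data.Nat using (ℕ)
open import Data.Product using (_×_; _,_; ∃-syntax)
open import Relation.Nullary using (Dec; yes; no)
import Relation.Binary.PropositionalEquality as ≡
import Relation.Binary.Reasoning.Setoid as SetoidReasoning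

module Derivations {n : ℕ} (γ : Lab n → Lab n → Lab n) (isCommFun : IsCommFun γ) where
  open IsCommFun isCommFun

  infix  4 _≋_ _≋ᵐ_
  infixr 4 _▸_
  infix  8 _·?_

  _≋_ : Term n → Term n → Set
  x ≋ y = γ ⊢ x ≈ y

  _▸_ : ∀ {x y z} → x ≋ y → y ≋ z → x ≋ z
  _▸_ = trans

  δ : Term n
  δ = con dlt

  +-idempotentCommutativeMonoid : IdempotentCommutativeMonoid _ _
  +-idempotentCommutativeMonoid = record
    { Carrier = Term n ; _≈_ = _≋_ ; _∙_ = _+ₜ_ ; ε = δ
    ; isIdempotentCommutativeMonoid = record
      { isCommutativeMonoid = record
        { isMonoid = record
          { isSemigroup = record
            { isMagma = record
              { isEquivalence = record { refl = refl ; sym = sym ; trans = trans }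
              ; ∙-cong = +-cong }
            ; assoc = A2 }
          ; identity = (λ x → A1 δ x ▸ A6 x) , A6 }
        ; comm = A1 }
      ; idem = A3 } }

  open IdempotentCommutativeMonoid +-idempotentCommutativeMonoid using (setoid)
  open IdempotentCommutativeMonoidSolver +-idempotentCommutativeMonoid using (solve; _⊜_; _⊕_; id)
  open SetoidReasoning setoid

  private
    variable
      a b : Lab n
      s t u v w x y z : Term n
      L M N P Q R : Maybe (Term n)

  -- `nothing` encodes both successful termination of a continuation and the absence of a
  -- delayed summand.
  _·?_ : Lab n → Maybe (Term n) → Term n
  a ·? nothing = con a
  a ·? just p  = con a ·ₜ p

  σ? : Maybe (Term n) → Term n
  σ? nothing  = δ
  σ? (just p) = σ p

  unionWith : (Term n → Term n → Term n) → Maybe (Term n) → Maybe (Term n) → Maybe (Term n)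
  unionWith f nothing  Q        = Q
  unionWith f (just p) nothing  = just p
  unionWith f (just p) (just q) = just (f p q)

  _≋ᵐ_ : Maybe (Term n) → Maybe (Term n) → Set
  _≋ᵐ_ = Pointwise _≋_

  ≋ᵐ-refl : M ≋ᵐ M
  ≋ᵐ-refl = Pointwise.refl refl

  ≋ᵐ-sym : M ≋ᵐ N → N ≋ᵐ M
  ≋ᵐ-sym = Pointwise.sym sym

  ·?-cong : a ≡.≡ b → M ≋ᵐ N → a ·? M ≋ b ·? N
  ·?-cong ≡.refl nothing  = refl
  ·?-cong ≡.refl (just e) = ·-cong refl e

  σ?-cong : M ≋ᵐ N → σ? M ≋ σ? N
  σ?-cong nothing  = refl
  σ?-cong (just e) = σ-cong e

  ν-·? : ∀ a P → ν (a ·? P) ≋ a ·? P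
  ν-·? a nothing  = NU1 a
  ν-·? a (just p) = NU3 _ _ ▸ ·-cong (NU1 a) refl

  ·?-⌊⌊ : ∀ a P z → (a ·? P) ⌊⌊ z ≋ a ·? unionWith _∥_ P (just z)
  ·?-⌊⌊ a nothing  z = CM2 a z
  ·?-⌊⌊ a (just p) z = CM3 a p z

  ·?-∣-·? : ∀ a b P Q → (a ·? P) ∣ₜ (b ·? Q) ≋ γ a b ·? unionWith _∥_ P Q
  ·?-∣-·? a b nothing  nothing  = CF a b _ ≡.refl
  ·?-∣-·? a b nothing  (just q) = CM7 a b q ▸ ·-cong (CF a b _ ≡.refl) refl
  ·?-∣-·? a b (just p) nothing  = CM6 a b p ▸ ·-cong (CF a b _ ≡.refl) refl
  ·?-∣-·? a b (just p) (just q) = CM8 a b p q ▸ ·-cong (CF a b _ ≡.refl) refl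

  dlt-·? : ∀ P → dlt ·? P ≋ δ
  dlt-·? nothing  = refl
  dlt-·? (just p) = A7 p

  ·?-∣-·?-deadlock : ∀ P Q → γ a b ≡.≡ dlt → (a ·? P) ∣ₜ (b ·? Q) ≋ δ
  ·?-∣-·?-deadlock {a} {b} P Q γab≡dlt =
    ·?-∣-·? a b P Q ▸ ·?-cong γab≡dlt ≋ᵐ-refl ▸ dlt-·? _

  ∣-comm⇒∥-comm : x ∣ₜ y ≋ y ∣ₜ x → x ∥ y ≋ y ∥ x
  ∣-comm⇒∥-comm x∣y≋y∣x = CM1 _ _ ▸ +-cong (A1 _ _) x∣y≋y∣x ▸ sym (CM1 _ _)

  ∥-⌊⌊-expand : ∀ x y z → (x ∥ y) ⌊⌊ z ≋ ((x ⌊⌊ y) ⌊⌊ z +ₜ (y ⌊⌊ x) ⌊⌊ z) +ₜ (x ∣ₜ y) ⌊⌊ z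
  ∥-⌊⌊-expand x y z = ⌊⌊-cong (CM1 x y) refl ▸ CM5 _ _ _ ▸ +-cong (CM5 _ _ _) refl

  ∥-∣-expand : ∀ x y z → (x ∥ y) ∣ₜ z ≋ ((x ⌊⌊ y) ∣ₜ z +ₜ (y ⌊⌊ x) ∣ₜ z) +ₜ (x ∣ₜ y) ∣ₜ z
  ∥-∣-expand x y z = ∣-cong (CM1 x y) refl ▸ CM10 _ _ _ ▸ +-cong (CM10 _ _ _) refl

  ∣-∥-expand : ∀ x y z → x ∣ₜ (y ∥ z) ≋ (x ∣ₜ (y ⌊⌊ z) +ₜ x ∣ₜ (z ⌊⌊ y)) +ₜ x ∣ₜ (y ∣ₜ z)
  ∣-∥-expand x y z = ∣-cong refl (CM1 y z) ▸ CM11 _ _ _ ▸ +-cong (CM11 _ _ _) refl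

  mutual
    data Immediate : Term n → Set where
      prefix : ∀ a → All Basic P → Immediate (a ·? P)
      _+ᵢ_   : Immediate u → Immediate v → Immediate (u +ₜ v)

    data Basic : Term n → Set where
      _+σ_ : Immediate u → All Basic M → Basic (u +ₜ σ? M)

  ν-immediate : Immediate u → ν u ≋ u
  ν-immediate (prefix {P} a _) = ν-·? a P
  ν-immediate (iu +ᵢ iv)       = NU2 _ _ ▸ +-cong (ν-immediate iu) (ν-immediate iv)

  δ-∣-immediate : Immediate v → δ ∣ₜ v ≋ δ
  δ-∣-immediate (prefix {Q} b _) = ·?-∣-·?-deadlock nothing Q (dlt-l b)
  δ-∣-immediate (iv +ᵢ iv')      =
    CM11 _ _ _ ▸ +-cong (δ-∣-immediate iv) (δ-∣-immediate iv') ▸ A3 δ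

  immediate-∣-δ : Immediate u → u ∣ₜ δ ≋ δ
  immediate-∣-δ (prefix {P} a _) = ·?-∣-·?-deadlock P nothing (≡.trans (comm a dlt) (dlt-l a))
  immediate-∣-δ (iu +ᵢ iu')      =
    CM10 _ _ _ ▸ +-cong (immediate-∣-δ iu) (immediate-∣-δ iu') ▸ A3 δ

  ImmediateForm : Term n → Set
  ImmediateForm t = ∃[ u ] Immediate u × t ≋ u

  immediateForm : Immediate u → ImmediateForm u
  immediateForm iu = _ , iu , refl

  immediateForm-resp : s ≋ t → ImmediateForm t → ImmediateForm s
  immediateForm-resp s≋t (u , iu , t≋u) = u , iu , s≋t ▸ t≋u

  +-immediateForm : ImmediateForm s → ImmediateForm t → ImmediateForm (s +ₜ t)
  +-immediateForm (u , iu , eu) (v , iv , ev) = u +ₜ v , iu +ᵢ iv , +-cong eu ev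

  ν-immediateForm : ImmediateForm t → ν t ≋ t
  ν-immediateForm (u , iu , t≋u) = ν-cong t≋u ▸ ν-immediate iu ▸ sym t≋u

  σ?-⌊⌊ : ν t ≋ t → ∀ M N → σ? M ⌊⌊ (t +ₜ σ? N) ≋ σ? (zipWith _⌊⌊_ M N)
  σ?-⌊⌊ νt nothing  N        = CM2 dlt _ ▸ A7 _
  σ?-⌊⌊ νt (just p) nothing  = ⌊⌊-cong refl (A6 _ ▸ sym νt) ▸ CM4a _ _
  σ?-⌊⌊ νt (just p) (just q) = ⌊⌊-cong refl (+-cong (sym νt) refl) ▸ CM4b _ _ _

  σ?-∣-σ? : ∀ M N → σ? M ∣ₜ σ? N ≋ σ? (zipWith _∣ₜ_ M N)
  σ?-∣-σ? nothing  nothing  = ·?-∣-·?-deadlock nothing nothing (dlt-l dlt)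
  σ?-∣-σ? nothing  (just q) = ∣-cong (sym (NU1 dlt)) refl ▸ CM9a _ _
  σ?-∣-σ? (just p) nothing  = ∣-cong refl (sym (NU1 dlt)) ▸ CM9b _ _
  σ?-∣-σ? (just p) (just q) = CM9c p q

  σ?-∣-immediateForm : ImmediateForm t → ∀ M → σ? M ∣ₜ t ≋ δ
  σ?-∣-immediateForm (u , iu , t≋u) nothing  = ∣-cong refl t≋u ▸ δ-∣-immediate iu
  σ?-∣-immediateForm it             (just p) =
    ∣-cong refl (sym (ν-immediateForm it)) ▸ CM9b _ _

  immediateForm-∣-σ? : ImmediateForm t → ∀ M → t ∣ₜ σ? M ≋ δ
  immediateForm-∣-σ? (u , iu , t≋u) nothing  = ∣-cong t≋u refl ▸ immediate-∣-δ iu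
  immediateForm-∣-σ? it             (just p) =
    ∣-cong (sym (ν-immediateForm it)) refl ▸ CM9a _ _

  ⌊⌊-expand : ν t ≋ t → s ≋ t +ₜ σ? N → ∀ M →
              (u +ₜ σ? M) ⌊⌊ s ≋ u ⌊⌊ s +ₜ σ? (zipWith _⌊⌊_ M N)
  ⌊⌊-expand {N = N} νt s≋ M = CM5 _ _ _ ▸ +-cong refl (⌊⌊-cong refl s≋ ▸ σ?-⌊⌊ νt M N)

  ∣-expand : ImmediateForm s → ImmediateForm t → ∀ M N →
             (s +ₜ σ? M) ∣ₜ (t +ₜ σ? N) ≋ s ∣ₜ t +ₜ σ? (zipWith _∣ₜ_ M N)
  ∣-expand {s} {t} is it M N =
    CM10 _ _ _ ▸ +-cong (CM11 _ _ _) (CM11 _ _ _)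
    ▸ +-cong (+-cong refl (immediateForm-∣-σ? is N))
             (+-cong (σ?-∣-immediateForm it M) (σ?-∣-σ? M N))
    ▸ solve 2 (λ c d → (c ⊕ id) ⊕ (id ⊕ d) ⊜ c ⊕ d) refl (s ∣ₜ t) (σ? (zipWith _∣ₜ_ M N))

  ∥-expand : Immediate v → Immediate w → ∀ M N →
             (v +ₜ σ? M) ∥ (w +ₜ σ? N)
             ≋ ((v ⌊⌊ (w +ₜ σ? N) +ₜ w ⌊⌊ (v +ₜ σ? M)) +ₜ v ∣ₜ w) +ₜ σ? (zipWith _∥_ M N)
  ∥-expand {v} {w} iv iw M N =
    CM1 _ _
    ▸ +-cong (+-cong (⌊⌊-expand (ν-immediate iw) refl M) (⌊⌊-expand (ν-immediate iv) refl N))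
             (∣-expand (immediateForm iv) (immediateForm iw) M N)
    ▸ solve 6 (λ l l′ c m m′ d → ((l ⊕ m) ⊕ (l′ ⊕ m′)) ⊕ (c ⊕ d) ⊜ ((l ⊕ l′) ⊕ c) ⊕ ((m ⊕ m′) ⊕ d))
        refl (v ⌊⌊ (w +ₜ σ? N)) (w ⌊⌊ (v +ₜ σ? M)) (v ∣ₜ w)
        (σ? (zipWith _⌊⌊_ M N)) (σ? (zipWith _⌊⌊_ N M)) (σ? (zipWith _∣ₜ_ M N))
    ▸ +-cong refl (σ?-∥ M N)
    where
    σ?-∥ : ∀ M N → (σ? (zipWith _⌊⌊_ M N) +ₜ σ? (zipWith _⌊⌊_ N M)) +ₜ σ? (zipWith _∣ₜ_ M N)
                   ≋ σ? (zipWith _∥_ M N)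
    σ?-∥ nothing  nothing  = +-cong (A3 δ) refl ▸ A3 δ
    σ?-∥ nothing  (just q) = +-cong (A3 δ) refl ▸ A3 δ
    σ?-∥ (just p) nothing  = +-cong (A3 δ) refl ▸ A3 δ
    σ?-∥ (just p) (just q) = +-cong (DRT1 _ _) refl ▸ DRT1 _ _ ▸ σ-cong (sym (CM1 p q))

  σ?-+ : ∀ M N → σ? M +ₜ σ? N ≋ σ? (unionWith _+ₜ_ M N)
  σ?-+ nothing  N        = A1 _ _ ▸ A6 _
  σ?-+ (just p) nothing  = A6 _
  σ?-+ (just p) (just q) = DRT1 p q

  ν-σ? : ∀ M → ν (σ? M) ≋ δ
  ν-σ? nothing  = NU1 dlt
  ν-σ? (just p) = NU4 p

  BasicForm : Term n → Set
  BasicForm t = ∃[ r ] Basic r × t ≋ r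

  RemainderForm : Maybe (Term n) → Set
  RemainderForm M = ∃[ R ] All Basic R × M ≋ᵐ R

  basicForm-resp : s ≋ t → BasicForm t → BasicForm s
  basicForm-resp s≋t (r , br , t≋r) = r , br , s≋t ▸ t≋r

  immediateForm⇒basicForm : ImmediateForm t → BasicForm t
  immediateForm⇒basicForm (u , iu , t≋u) = u +ₜ δ , iu +σ nothing , t≋u ▸ sym (A6 u)

  remainderForm : All Basic M → RemainderForm M
  remainderForm bM = _ , bM , ≋ᵐ-refl

  basicForm₁ : (F : Term n → Term n) → (∀ {x x′} → x ≋ x′ → F x ≋ F x′) →
               (∀ {x} → Basic x → BasicForm (F x)) → BasicForm x → BasicForm (F x)
  basicForm₁ F F-cong F-basic (_ , bx , ex) = basicForm-resp (F-cong ex) (F-basic bx)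

  basicForm₂ : (F : Term n → Term n → Term n) →
               (∀ {x x′ y y′} → x ≋ x′ → y ≋ y′ → F x y ≋ F x′ y′) →
               (∀ {x y} → Basic x → Basic y → BasicForm (F x y)) →
               BasicForm x → BasicForm y → BasicForm (F x y)
  basicForm₂ F F-cong F-basic (_ , bx , ex) (_ , by , ey) =
    basicForm-resp (F-cong ex ey) (F-basic bx by)

  mutual
    +-basicForm : Basic x → Basic y → BasicForm (x +ₜ y)
    +-basicForm (_+σ_ {u} {M} iu bM) (_+σ_ {v} {N} iv bN) =
      let (R , bR , eR) = +-remainderForm bM bN in
      (u +ₜ v) +ₜ σ? R , (iu +ᵢ iv) +σ bR ,
      solve 4 (λ u m v n → (u ⊕ m) ⊕ (v ⊕ n) ⊜ (u ⊕ v) ⊕ (m ⊕ n)) refl u (σ? M) v (σ? N)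
      ▸ +-cong refl (σ?-+ M N ▸ σ?-cong eR)

    +-remainderForm : All Basic M → All Basic N → RemainderForm (unionWith _+ₜ_ M N)
    +-remainderForm nothing   bN        = remainderForm bN
    +-remainderForm (just bp) nothing   = remainderForm (just bp)
    +-remainderForm (just bp) (just bq) =
      let (r , br , e) = +-basicForm bp bq in just r , just br , just e

  mutual
    ·-immediateForm : Immediate u → Basic t → ImmediateForm (u ·ₜ t)
    ·-immediateForm (prefix a nothing)   bt = _ , prefix a (just bt) , refl
    ·-immediateForm (prefix a (just bp)) bt =
      let (r , br , e) = ·-basicForm bp bt in
      con a ·ₜ r , prefix a (just br) , A5 _ _ _ ▸ ·-cong refl e
    ·-immediateForm (iu +ᵢ iv) bt =
      immediateForm-resp (A4 _ _ _) (+-immediateForm (·-immediateForm iu bt) (·-immediateForm iv bt))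

    ·-basicForm : Basic x → Basic t → BasicForm (x ·ₜ t)
    ·-basicForm (iu +σ nothing) bt =
      let (r , ir , e) = ·-immediateForm iu bt in
      r +ₜ δ , ir +σ nothing , A4 _ _ _ ▸ +-cong e (A7 _)
    ·-basicForm (iu +σ just bp) bt =
      let (r , ir , e) = ·-immediateForm iu bt in
      let (r′ , br′ , e′) = ·-basicForm bp bt in
      r +ₜ σ r′ , ir +σ just br′ , A4 _ _ _ ▸ +-cong e (DRT2 _ _ ▸ σ-cong e′)

  σ-basicForm : Basic x → BasicForm (σ x)
  σ-basicForm {x} bx = δ +ₜ σ x , prefix dlt nothing +σ just bx , sym (A1 δ (σ x) ▸ A6 (σ x))

  ν-basicForm : Basic x → BasicForm (ν x)
  ν-basicForm (_+σ_ {u} {M} iu _) =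
    immediateForm⇒basicForm (u , iu , NU2 _ _ ▸ +-cong (ν-immediate iu) (ν-σ? M) ▸ A6 u)

  record IsRenaming (f : Term n → Term n) : Set where
    field
      con-renamed : ∀ a → ∃[ b ] f (con a) ≋ con b
      δ-fixed     : f δ ≋ δ
      +-hom       : ∀ x y → f (x +ₜ y) ≋ f x +ₜ f y
      ·-hom       : ∀ x y → f (x ·ₜ y) ≋ f x ·ₜ f y
      σ-hom       : ∀ x → f (σ x) ≋ σ (f x)

  module _ {f : Term n → Term n} (isRenaming : IsRenaming f) where
    open IsRenaming isRenaming

    mutual
      renaming-immediateForm : Immediate u → ImmediateForm (f u)
      renaming-immediateForm (prefix a nothing) =
        let (b , e) = con-renamed a in con b , prefix b nothing , e
      renaming-immediateForm (prefix a (just bp)) =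
        let (b , e) = con-renamed a in
        let (r , br , e′) = renaming-basicForm bp in
        con b ·ₜ r , prefix b (just br) , ·-hom _ _ ▸ ·-cong e e′
      renaming-immediateForm (iu +ᵢ iv) =
        immediateForm-resp (+-hom _ _)
          (+-immediateForm (renaming-immediateForm iu) (renaming-immediateForm iv))

      renaming-basicForm : Basic x → BasicForm (f x)
      renaming-basicForm (iu +σ nothing) =
        let (r , ir , e) = renaming-immediateForm iu in
        r +ₜ δ , ir +σ nothing , +-hom _ _ ▸ +-cong e δ-fixed
      renaming-basicForm (iu +σ just bp) =
        let (r , ir , e) = renaming-immediateForm iu in
        let (r′ , br′ , e′) = renaming-basicForm bp in
        r +ₜ σ r′ , ir +σ just br′ , +-hom _ _ ▸ +-cong e (σ-hom _ ▸ σ-cong e′)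

  _∈L?_ : ∀ a (H : Subset n) → Dec (a ∈L H)
  act i ∈L? H = i ∈? H
  tau   ∈L? H = no λ ()
  dlt   ∈L? H = no λ ()

  ∂-con : ∀ H a → ∃[ b ] ∂ H (con a) ≋ con b
  ∂-con H a with a ∈L? H
  ... | yes a∈H = dlt , D2 H a a∈H
  ... | no  a∉H = a , D1 H a a∉H

  τI-con : ∀ I a → ∃[ b ] τI I (con a) ≋ con b
  τI-con I a with a ∈L? I
  ... | yes a∈I = tau , T2 I a a∈I
  ... | no  a∉I = a , T1 I a a∉I

  ∂-isRenaming : ∀ H → IsRenaming (∂ H)
  ∂-isRenaming H = record
    { con-renamed = ∂-con H ; δ-fixed = D1 H dlt λ () ; +-hom = D3 H ; ·-hom = D4 H ; σ-hom = D5 H }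

  τI-isRenaming : ∀ I → IsRenaming (τI I)
  τI-isRenaming I = record
    { con-renamed = τI-con I ; δ-fixed = T1 I dlt λ () ; +-hom = T3 I ; ·-hom = T4 I ; σ-hom = T5 I }

  mutual
    ∥?-remainderForm : All Basic P → All Basic Q → RemainderForm (unionWith _∥_ P Q)
    ∥?-remainderForm nothing   nothing   = remainderForm nothing
    ∥?-remainderForm (just bp) nothing   = remainderForm (just bp)
    ∥?-remainderForm bP        (just bq) = ∥?-just-remainderForm bP bq

    -- The `just z` instances get their own lemmas: passing `just bz` to the general one would
    -- hide from the termination checker that bz is passed on unchanged.
    ∥?-just-remainderForm : All Basic P → Basic z → RemainderForm (unionWith _∥_ P (just z))
    ∥?-just-remainderForm nothing   bz = remainderForm (just bz)
    ∥?-just-remainderForm (just bp) bz =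
      let (r , br , e) = ∥-basicForm bp bz in just r , just br , just e

    ⌊⌊-immediateForm : Immediate u → Basic z → ImmediateForm (u ⌊⌊ z)
    ⌊⌊-immediateForm (prefix {P} a bP) bz =
      let (R , bR , e) = ∥?-just-remainderForm bP bz in
      a ·? R , prefix a bR , ·?-⌊⌊ a P _ ▸ ·?-cong ≡.refl e
    ⌊⌊-immediateForm (iu +ᵢ iv) bz =
      immediateForm-resp (CM5 _ _ _) (+-immediateForm (⌊⌊-immediateForm iu bz) (⌊⌊-immediateForm iv bz))

    ⌊⌊-remainderForm : All Basic M → All Basic N → RemainderForm (zipWith _⌊⌊_ M N)
    ⌊⌊-remainderForm nothing   _         = remainderForm nothing
    ⌊⌊-remainderForm (just _)  nothing   = remainderForm nothing
    ⌊⌊-remainderForm (just bp) (just bq) =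
      let (r , br , e) = ⌊⌊-basicForm bp bq in just r , just br , just e

    ⌊⌊-basicForm : Basic x → Basic z → BasicForm (x ⌊⌊ z)
    ⌊⌊-basicForm (_+σ_ {M = M} iu bM) bz@(iw +σ bN) =
      let (r , ir , e) = ⌊⌊-immediateForm iu bz in
      let (R , bR , eR) = ⌊⌊-remainderForm bM bN in
      r +ₜ σ? R , ir +σ bR , ⌊⌊-expand (ν-immediate iw) refl M ▸ +-cong e (σ?-cong eR)

    ∣-immediateForm : Immediate u → Immediate v → ImmediateForm (u ∣ₜ v)
    ∣-immediateForm (iu +ᵢ iu′) iv =
      immediateForm-resp (CM10 _ _ _) (+-immediateForm (∣-immediateForm iu iv) (∣-immediateForm iu′ iv))
    ∣-immediateForm iu@(prefix _ _) (iv +ᵢ iv′) =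
      immediateForm-resp (CM11 _ _ _) (+-immediateForm (∣-immediateForm iu iv) (∣-immediateForm iu iv′))
    ∣-immediateForm (prefix {P} a bP) (prefix {Q} b bQ) =
      let (R , bR , e) = ∥?-remainderForm bP bQ in
      γ a b ·? R , prefix (γ a b) bR , ·?-∣-·? a b P Q ▸ ·?-cong ≡.refl e

    ∣-remainderForm : All Basic M → All Basic N → RemainderForm (zipWith _∣ₜ_ M N)
    ∣-remainderForm nothing   _         = remainderForm nothing
    ∣-remainderForm (just _)  nothing   = remainderForm nothing
    ∣-remainderForm (just bp) (just bq) =
      let (r , br , e) = ∣-basicForm bp bq in just r , just br , just e

    ∣-basicForm : Basic x → Basic y → BasicForm (x ∣ₜ y)
    ∣-basicForm (_+σ_ {M = M} iu bM) (_+σ_ {M = N} iv bN) =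
      let (r , ir , e) = ∣-immediateForm iu iv in
      let (R , bR , eR) = ∣-remainderForm bM bN in
      r +ₜ σ? R , ir +σ bR ,
      ∣-expand (immediateForm iu) (immediateForm iv) M N ▸ +-cong e (σ?-cong eR)

    ∥-basicForm : Basic x → Basic y → BasicForm (x ∥ y)
    ∥-basicForm bx by =
      basicForm-resp (CM1 _ _)
        (+-basicForm′ (+-basicForm′ (⌊⌊-basicForm bx by) (⌊⌊-basicForm by bx)) (∣-basicForm bx by))
      where
      +-basicForm′ : BasicForm s → BasicForm t → BasicForm (s +ₜ t)
      +-basicForm′ = basicForm₂ _+ₜ_ +-cong +-basicForm

  basicForm : ∀ t → BasicForm t
  basicForm (con a)  = immediateForm⇒basicForm (immediateForm (prefix a nothing))
  basicForm (x +ₜ y) = basicForm₂ _+ₜ_ +-cong +-basicForm (basicForm x) (basicForm y)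
  basicForm (x ·ₜ y) = basicForm₂ _·ₜ_ ·-cong ·-basicForm (basicForm x) (basicForm y)
  basicForm (x ∥ y)  = basicForm₂ _∥_ ∥-cong ∥-basicForm (basicForm x) (basicForm y)
  basicForm (x ⌊⌊ y) = basicForm₂ _⌊⌊_ ⌊⌊-cong ⌊⌊-basicForm (basicForm x) (basicForm y)
  basicForm (x ∣ₜ y) = basicForm₂ _∣ₜ_ ∣-cong ∣-basicForm (basicForm x) (basicForm y)
  basicForm (σ x)    = basicForm₁ σ σ-cong σ-basicForm (basicForm x)
  basicForm (ν x)    = basicForm₁ ν ν-cong ν-basicForm (basicForm x)
  basicForm (∂ H x)  =
    basicForm₁ (∂ H) ∂-cong (renaming-basicForm (∂-isRenaming H)) (basicForm x)
  basicForm (τI I x) =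
    basicForm₁ (τI I) τI-cong (renaming-basicForm (τI-isRenaming I)) (basicForm x)

  mutual
    ∣-comm-immediate : Immediate u → Immediate v → u ∣ₜ v ≋ v ∣ₜ u
    ∣-comm-immediate (iu +ᵢ iu′) iv =
      CM10 _ _ _ ▸ +-cong (∣-comm-immediate iu iv) (∣-comm-immediate iu′ iv) ▸ sym (CM11 _ _ _)
    ∣-comm-immediate iu@(prefix _ _) (iv +ᵢ iv′) =
      CM11 _ _ _ ▸ +-cong (∣-comm-immediate iu iv) (∣-comm-immediate iu iv′) ▸ sym (CM10 _ _ _)
    ∣-comm-immediate (prefix {P} a bP) (prefix {Q} b bQ) =
      ·?-∣-·? a b P Q ▸ ·?-cong (comm a b) (∥?-comm bP bQ) ▸ sym (·?-∣-·? b a Q P)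

    ∥?-comm : All Basic P → All Basic Q → unionWith _∥_ P Q ≋ᵐ unionWith _∥_ Q P
    ∥?-comm nothing   nothing   = nothing
    ∥?-comm nothing   (just _)  = just refl
    ∥?-comm (just _)  nothing   = just refl
    ∥?-comm (just bp) (just bq) = just (∣-comm⇒∥-comm (∣-comm-basic bp bq))

    ∣-comm-remainder : All Basic M → All Basic N → zipWith _∣ₜ_ M N ≋ᵐ zipWith _∣ₜ_ N M
    ∣-comm-remainder nothing   nothing   = nothing
    ∣-comm-remainder nothing   (just _)  = nothing
    ∣-comm-remainder (just _)  nothing   = nothing
    ∣-comm-remainder (just bp) (just bq) = just (∣-comm-basic bp bq)

    ∣-comm-basic : Basic x → Basic y → x ∣ₜ y ≋ y ∣ₜ x
    ∣-comm-basic (_+σ_ {M = M} iu bM) (_+σ_ {M = N} iv bN) =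
      ∣-expand (immediateForm iu) (immediateForm iv) M N
      ▸ +-cong (∣-comm-immediate iu iv) (σ?-cong (∣-comm-remainder bM bN))
      ▸ sym (∣-expand (immediateForm iv) (immediateForm iu) N M)

  ∣-comm : ∀ x y → x ∣ₜ y ≋ y ∣ₜ x
  ∣-comm x y with basicForm x | basicForm y
  ... | _ , bx , ex | _ , by , ey = ∣-cong ex ey ▸ ∣-comm-basic bx by ▸ sym (∣-cong ey ex)

  ∥-comm : ∀ x y → x ∥ y ≋ y ∥ x
  ∥-comm x y = ∣-comm⇒∥-comm (∣-comm x y)

  mutual
    ∥?-assoc : All Basic P → All Basic Q → All Basic R →
               unionWith _∥_ (unionWith _∥_ P Q) R ≋ᵐ unionWith _∥_ P (unionWith _∥_ Q R)
    ∥?-assoc nothing  _        _         = ≋ᵐ-refl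
    ∥?-assoc (just _) nothing  _         = ≋ᵐ-refl
    ∥?-assoc (just _) (just _) nothing   = just refl
    ∥?-assoc bP       bQ       (just br) = ∥?-just-assoc bP bQ br

    -- Separate instances for the termination checker, as for ∥?-just-remainderForm.
    ∥?-just-assoc : All Basic P → All Basic Q → Basic z →
                    unionWith _∥_ (unionWith _∥_ P Q) (just z) ≋ᵐ unionWith _∥_ P (unionWith _∥_ Q (just z))
    ∥?-just-assoc nothing   _         _  = ≋ᵐ-refl
    ∥?-just-assoc (just _)  nothing   _  = ≋ᵐ-refl
    ∥?-just-assoc (just bp) (just bq) bz = just (∥-assoc-basic bp bq bz)

    ∥?-just-just-assoc : All Basic P → Basic y → Basic z →
                         unionWith _∥_ (unionWith _∥_ P (just y)) (just z) ≋ᵐ unionWith _∥_ P (just (y ∥ z))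
    ∥?-just-just-assoc nothing   _  _  = ≋ᵐ-refl
    ∥?-just-just-assoc (just bp) by bz = just (∥-assoc-basic bp by bz)

    ⌊⌊-assoc-immediate : Immediate u → Basic y → Basic z → (u ⌊⌊ y) ⌊⌊ z ≋ u ⌊⌊ (y ∥ z)
    ⌊⌊-assoc-immediate {y = y} {z = z} (prefix {P} a bP) by bz =
      ⌊⌊-cong (·?-⌊⌊ a P y) refl ▸ ·?-⌊⌊ a _ z
      ▸ ·?-cong ≡.refl (∥?-just-just-assoc bP by bz) ▸ sym (·?-⌊⌊ a P (y ∥ z))
    ⌊⌊-assoc-immediate (iu +ᵢ iu′) by bz =
      ⌊⌊-cong (CM5 _ _ _) refl ▸ CM5 _ _ _
      ▸ +-cong (⌊⌊-assoc-immediate iu by bz) (⌊⌊-assoc-immediate iu′ by bz) ▸ sym (CM5 _ _ _)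

    ⌊⌊-assoc-remainder : All Basic L → All Basic M → All Basic N →
                         zipWith _⌊⌊_ (zipWith _⌊⌊_ L M) N ≋ᵐ zipWith _⌊⌊_ L (zipWith _∥_ M N)
    ⌊⌊-assoc-remainder nothing   _         _         = nothing
    ⌊⌊-assoc-remainder (just _)  nothing   _         = nothing
    ⌊⌊-assoc-remainder (just _)  (just _)  nothing   = nothing
    ⌊⌊-assoc-remainder (just bp) (just bq) (just br) = just (⌊⌊-assoc-basic bp bq br)

    ⌊⌊-assoc-basic : Basic x → Basic y → Basic z → (x ⌊⌊ y) ⌊⌊ z ≋ x ⌊⌊ (y ∥ z)
    ⌊⌊-assoc-basic {x} {y} {z} (_+σ_ {u} {L} iu bL) by@(_+σ_ {v} {M} iv bM) bz@(_+σ_ {w} {N} iw bN) =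
      begin
        (x ⌊⌊ y) ⌊⌊ z
      ≈⟨ ⌊⌊-cong (⌊⌊-expand (ν-immediate iv) refl L) refl ⟩
        (u ⌊⌊ y +ₜ σ? (zipWith _⌊⌊_ L M)) ⌊⌊ z
      ≈⟨ ⌊⌊-expand (ν-immediate iw) refl (zipWith _⌊⌊_ L M) ⟩
        (u ⌊⌊ y) ⌊⌊ z +ₜ σ? (zipWith _⌊⌊_ (zipWith _⌊⌊_ L M) N)
      ≈⟨ +-cong (⌊⌊-assoc-immediate iu by bz) (σ?-cong (⌊⌊-assoc-remainder bL bM bN)) ⟩
        u ⌊⌊ (y ∥ z) +ₜ σ? (zipWith _⌊⌊_ L (zipWith _∥_ M N))
      ≈⟨ ⌊⌊-expand (ν-immediateForm y∥z-immediate) (∥-expand iv iw M N) L ⟨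
        x ⌊⌊ (y ∥ z)
      ∎
      where
      y∥z-immediate : ImmediateForm ((v ⌊⌊ z +ₜ w ⌊⌊ y) +ₜ v ∣ₜ w)
      y∥z-immediate =
        +-immediateForm (+-immediateForm (⌊⌊-immediateForm iv bz) (⌊⌊-immediateForm iw by))
                        (∣-immediateForm iv iw)

    ∣-⌊⌊-assoc-immediate : Immediate u → Immediate v → Basic z → u ∣ₜ (v ⌊⌊ z) ≋ (u ∣ₜ v) ⌊⌊ z
    ∣-⌊⌊-assoc-immediate (iu +ᵢ iu′) iv bz =
      CM10 _ _ _ ▸ +-cong (∣-⌊⌊-assoc-immediate iu iv bz) (∣-⌊⌊-assoc-immediate iu′ iv bz)
      ▸ sym (CM5 _ _ _) ▸ ⌊⌊-cong (sym (CM10 _ _ _)) refl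
    ∣-⌊⌊-assoc-immediate iu@(prefix _ _) (iv +ᵢ iv′) bz =
      ∣-cong refl (CM5 _ _ _) ▸ CM11 _ _ _
      ▸ +-cong (∣-⌊⌊-assoc-immediate iu iv bz) (∣-⌊⌊-assoc-immediate iu iv′ bz)
      ▸ sym (CM5 _ _ _) ▸ ⌊⌊-cong (sym (CM11 _ _ _)) refl
    ∣-⌊⌊-assoc-immediate {z = z} (prefix {P} a bP) (prefix {Q} b bQ) bz =
      ∣-cong refl (·?-⌊⌊ b Q z) ▸ ·?-∣-·? a b P _
      ▸ ·?-cong ≡.refl (≋ᵐ-sym (∥?-just-assoc bP bQ bz))
      ▸ sym (⌊⌊-cong (·?-∣-·? a b P Q) refl ▸ ·?-⌊⌊ (γ a b) _ z)

    ∣-⌊⌊-assoc-remainder : All Basic L → All Basic M → All Basic N →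
                           zipWith _∣ₜ_ L (zipWith _⌊⌊_ M N) ≋ᵐ zipWith _⌊⌊_ (zipWith _∣ₜ_ L M) N
    ∣-⌊⌊-assoc-remainder nothing   _         _         = nothing
    ∣-⌊⌊-assoc-remainder (just _)  nothing   _         = nothing
    ∣-⌊⌊-assoc-remainder (just _)  (just _)  nothing   = nothing
    ∣-⌊⌊-assoc-remainder (just bp) (just bq) (just br) = just (∣-⌊⌊-assoc-basic bp bq br)

    ∣-⌊⌊-assoc-basic : Basic x → Basic y → Basic z → x ∣ₜ (y ⌊⌊ z) ≋ (x ∣ₜ y) ⌊⌊ z
    ∣-⌊⌊-assoc-basic (_+σ_ {M = L} iu bL) (_+σ_ {M = M} iv bM) bz@(iw +σ bN) =
      ∣-cong refl (⌊⌊-expand (ν-immediate iw) refl M)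
      ▸ ∣-expand (immediateForm iu) (⌊⌊-immediateForm iv bz) L _
      ▸ +-cong (∣-⌊⌊-assoc-immediate iu iv bz) (σ?-cong (∣-⌊⌊-assoc-remainder bL bM bN))
      ▸ sym (⌊⌊-cong (∣-expand (immediateForm iu) (immediateForm iv) L M) refl
             ▸ ⌊⌊-expand (ν-immediate iw) refl _)

    ∣-assoc-immediate : Immediate u → Immediate v → Immediate w → (u ∣ₜ v) ∣ₜ w ≋ u ∣ₜ (v ∣ₜ w)
    ∣-assoc-immediate (iu +ᵢ iu′) iv iw =
      ∣-cong (CM10 _ _ _) refl ▸ CM10 _ _ _
      ▸ +-cong (∣-assoc-immediate iu iv iw) (∣-assoc-immediate iu′ iv iw) ▸ sym (CM10 _ _ _)
    ∣-assoc-immediate iu@(prefix _ _) (iv +ᵢ iv′) iw =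
      ∣-cong (CM11 _ _ _) refl ▸ CM10 _ _ _
      ▸ +-cong (∣-assoc-immediate iu iv iw) (∣-assoc-immediate iu iv′ iw)
      ▸ sym (CM11 _ _ _) ▸ ∣-cong refl (sym (CM10 _ _ _))
    ∣-assoc-immediate iu@(prefix _ _) iv@(prefix _ _) (iw +ᵢ iw′) =
      CM11 _ _ _ ▸ +-cong (∣-assoc-immediate iu iv iw) (∣-assoc-immediate iu iv iw′)
      ▸ sym (CM11 _ _ _) ▸ ∣-cong refl (sym (CM11 _ _ _))
    ∣-assoc-immediate (prefix {P} a bP) (prefix {Q} b bQ) (prefix {R} c bR) =
      ∣-cong (·?-∣-·? a b P Q) refl ▸ ·?-∣-·? (γ a b) c _ R
      ▸ ·?-cong (assoc a b c) (∥?-assoc bP bQ bR)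
      ▸ sym (∣-cong refl (·?-∣-·? b c Q R) ▸ ·?-∣-·? a (γ b c) P _)

    ∣-assoc-remainder : All Basic L → All Basic M → All Basic N →
                        zipWith _∣ₜ_ (zipWith _∣ₜ_ L M) N ≋ᵐ zipWith _∣ₜ_ L (zipWith _∣ₜ_ M N)
    ∣-assoc-remainder nothing   _         _         = nothing
    ∣-assoc-remainder (just _)  nothing   _         = nothing
    ∣-assoc-remainder (just _)  (just _)  nothing   = nothing
    ∣-assoc-remainder (just bp) (just bq) (just br) = just (∣-assoc-basic bp bq br)

    ∣-assoc-basic : Basic x → Basic y → Basic z → (x ∣ₜ y) ∣ₜ z ≋ x ∣ₜ (y ∣ₜ z)
    ∣-assoc-basic (_+σ_ {M = L} iu bL) (_+σ_ {M = M} iv bM) (_+σ_ {M = N} iw bN) =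
      ∣-cong (∣-expand (immediateForm iu) (immediateForm iv) L M) refl
      ▸ ∣-expand (∣-immediateForm iu iv) (immediateForm iw) _ N
      ▸ +-cong (∣-assoc-immediate iu iv iw) (σ?-cong (∣-assoc-remainder bL bM bN))
      ▸ sym (∣-cong refl (∣-expand (immediateForm iv) (immediateForm iw) M N)
             ▸ ∣-expand (immediateForm iu) (∣-immediateForm iv iw) L _)

    ∥-assoc-basic : Basic x → Basic y → Basic z → (x ∥ y) ∥ z ≋ x ∥ (y ∥ z)
    ∥-assoc-basic {x} {y} {z} bx by bz =
      begin
        (x ∥ y) ∥ z
      ≈⟨ CM1 _ _ ⟩
        ((x ∥ y) ⌊⌊ z +ₜ z ⌊⌊ (x ∥ y)) +ₜ (x ∥ y) ∣ₜ z
      ≈⟨ +-cong (+-cong left-⌊⌊ refl) left-∣ ⟩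
        (((x ⌊⌊ (y ∥ z) +ₜ y ⌊⌊ (x ∥ z)) +ₜ (x ∣ₜ y) ⌊⌊ z) +ₜ z ⌊⌊ (x ∥ y))
        +ₜ (((x ∣ₜ z) ⌊⌊ y +ₜ (y ∣ₜ z) ⌊⌊ x) +ₜ x ∣ₜ (y ∣ₜ z))
      ≈⟨ solve 7 (λ a b c d e f g → (((a ⊕ b) ⊕ c) ⊕ d) ⊕ ((e ⊕ f) ⊕ g)
                                    ⊜ (a ⊕ ((b ⊕ d) ⊕ f)) ⊕ ((c ⊕ e) ⊕ g)) refl
           (x ⌊⌊ (y ∥ z)) (y ⌊⌊ (x ∥ z)) ((x ∣ₜ y) ⌊⌊ z) (z ⌊⌊ (x ∥ y))
           ((x ∣ₜ z) ⌊⌊ y) ((y ∣ₜ z) ⌊⌊ x) (x ∣ₜ (y ∣ₜ z)) ⟩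
        (x ⌊⌊ (y ∥ z) +ₜ ((y ⌊⌊ (x ∥ z) +ₜ z ⌊⌊ (x ∥ y)) +ₜ (y ∣ₜ z) ⌊⌊ x))
        +ₜ (((x ∣ₜ y) ⌊⌊ z +ₜ (x ∣ₜ z) ⌊⌊ y) +ₜ x ∣ₜ (y ∣ₜ z))
      ≈⟨ +-cong (+-cong refl right-⌊⌊) right-∣ ⟨
        (x ⌊⌊ (y ∥ z) +ₜ (y ∥ z) ⌊⌊ x) +ₜ x ∣ₜ (y ∥ z)
      ≈⟨ CM1 _ _ ⟨
        x ∥ (y ∥ z)
      ∎
      where
      ⌊⌊-∣-exchange : ∀ {p q r} → Basic p → Basic q → Basic r → (p ⌊⌊ q) ∣ₜ r ≋ (p ∣ₜ r) ⌊⌊ q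
      ⌊⌊-∣-exchange {p} {q} {r} bp bq br =
        ∣-comm (p ⌊⌊ q) r ▸ ∣-⌊⌊-assoc-basic br bp bq ▸ ⌊⌊-cong (∣-comm r p) refl

      left-⌊⌊ : (x ∥ y) ⌊⌊ z ≋ (x ⌊⌊ (y ∥ z) +ₜ y ⌊⌊ (x ∥ z)) +ₜ (x ∣ₜ y) ⌊⌊ z
      left-⌊⌊ = ∥-⌊⌊-expand x y z
        ▸ +-cong (+-cong (⌊⌊-assoc-basic bx by bz) (⌊⌊-assoc-basic by bx bz)) refl

      left-∣ : (x ∥ y) ∣ₜ z ≋ ((x ∣ₜ z) ⌊⌊ y +ₜ (y ∣ₜ z) ⌊⌊ x) +ₜ x ∣ₜ (y ∣ₜ z)
      left-∣ = ∥-∣-expand x y z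
        ▸ +-cong (+-cong (⌊⌊-∣-exchange bx by bz) (⌊⌊-∣-exchange by bx bz)) (∣-assoc-basic bx by bz)

      right-⌊⌊ : (y ∥ z) ⌊⌊ x ≋ (y ⌊⌊ (x ∥ z) +ₜ z ⌊⌊ (x ∥ y)) +ₜ (y ∣ₜ z) ⌊⌊ x
      right-⌊⌊ = ∥-⌊⌊-expand y z x
        ▸ +-cong (+-cong (⌊⌊-assoc-basic by bz bx ▸ ⌊⌊-cong refl (∥-comm z x))
                         (⌊⌊-assoc-basic bz by bx ▸ ⌊⌊-cong refl (∥-comm y x)))
                 refl

      right-∣ : x ∣ₜ (y ∥ z) ≋ ((x ∣ₜ y) ⌊⌊ z +ₜ (x ∣ₜ z) ⌊⌊ y) +ₜ x ∣ₜ (y ∣ₜ z)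
      right-∣ = ∣-∥-expand x y z
        ▸ +-cong (+-cong (∣-⌊⌊-assoc-basic bx by bz) (∣-⌊⌊-assoc-basic bx bz by)) refl

  lift-basic₃ : ∀ (F G : Term n → Term n → Term n → Term n) →
                (∀ {x x′ y y′ z z′} → x ≋ x′ → y ≋ y′ → z ≋ z′ → F x y z ≋ F x′ y′ z′) →
                (∀ {x x′ y y′ z z′} → x ≋ x′ → y ≋ y′ → z ≋ z′ → G x y z ≋ G x′ y′ z′) →
                (∀ {x y z} → Basic x → Basic y → Basic z → F x y z ≋ G x y z) →
                ∀ x y z → F x y z ≋ G x y z
  lift-basic₃ F G F-cong G-cong law x y z with basicForm x | basicForm y | basicForm z
  ... | _ , bx , ex | _ , by , ey | _ , bz , ez =
    F-cong ex ey ez ▸ law bx by bz ▸ sym (G-cong ex ey ez)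

  ∥-assoc : ∀ x y z → (x ∥ y) ∥ z ≋ x ∥ (y ∥ z)
  ∥-assoc = lift-basic₃ (λ x y z → (x ∥ y) ∥ z) (λ x y z → x ∥ (y ∥ z))
    (λ ex ey ez → ∥-cong (∥-cong ex ey) ez) (λ ex ey ez → ∥-cong ex (∥-cong ey ez)) ∥-assoc-basic

  ⌊⌊-assoc : ∀ x y z → (x ⌊⌊ y) ⌊⌊ z ≋ x ⌊⌊ (y ∥ z)
  ⌊⌊-assoc = lift-basic₃ (λ x y z → (x ⌊⌊ y) ⌊⌊ z) (λ x y z → x ⌊⌊ (y ∥ z))
    (λ ex ey ez → ⌊⌊-cong (⌊⌊-cong ex ey) ez) (λ ex ey ez → ⌊⌊-cong ex (∥-cong ey ez)) ⌊⌊-assoc-basic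

  ∣-assoc : ∀ x y z → (x ∣ₜ y) ∣ₜ z ≋ x ∣ₜ (y ∣ₜ z)
  ∣-assoc = lift-basic₃ (λ x y z → (x ∣ₜ y) ∣ₜ z) (λ x y z → x ∣ₜ (y ∣ₜ z))
    (λ ex ey ez → ∣-cong (∣-cong ex ey) ez) (λ ex ey ez → ∣-cong ex (∣-cong ey ez)) ∣-assoc-basic

  ∣-⌊⌊-assoc : ∀ x y z → x ∣ₜ (y ⌊⌊ z) ≋ (x ∣ₜ y) ⌊⌊ z
  ∣-⌊⌊-assoc = lift-basic₃ (λ x y z → x ∣ₜ (y ⌊⌊ z)) (λ x y z → (x ∣ₜ y) ⌊⌊ z)
    (λ ex ey ez → ∣-cong ex (⌊⌊-cong ey ez)) (λ ex ey ez → ⌊⌊-cong (∣-cong ex ey) ez) ∣-⌊⌊-assoc-basic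

theorem2 : (n : ℕ) (γ : Lab n → Lab n → Lab n) → IsCommFun γ →
    (x y z : Term n) →
      (γ ⊢ x ∥ y ≈ y ∥ x)
      × (γ ⊢ (x ∥ y) ∥ z ≈ x ∥ (y ∥ z))
      × (γ ⊢ (x ⌊⌊ y) ⌊⌊ z ≈ x ⌊⌊ (y ∥ z))
      × (γ ⊢ x ∣ₜ y ≈ y ∣ₜ x)
      × (γ ⊢ (x ∣ₜ y) ∣ₜ z ≈ x ∣ₜ (y ∣ₜ z))
      × (γ ⊢ x ∣ₜ (y ⌊⌊ z) ≈ (x ∣ₜ y) ⌊⌊ z)
theorem2 n γ isCommFun x y z =
  ∥-comm x y , ∥-assoc x y z , ⌊⌊-assoc x y z , ∣-comm x y , ∣-assoc x y z , ∣-⌊⌊-assoc x y z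
  where open Derivations γ isCommFun
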